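{- Let $G$ be a vertex decomposable graph on vertex set $\{x_1,\ldots,x_n\}$ and let $s_1,\ldots,s_n$ be integers with $s_i\ge 2$ for $1\le i\le n$. Then the graph expansion $G^{(s_1,\ldots,s_n)}$ is vertex decomposable and $\mathrm{Shed}(G^{(s_1,\ldots,s_n)})$ is a dominating set of $G^{(s_1,\ldots,s_n)}$.
   Context: For a graph $G$ on $\{x_1,\ldots,x_n\}$ and positive integers $s_1,\ldots,s_n$, the graph expansion $G^{(s_1,\ldots,s_n)}$ has vertex set $\{x_{i,j}: 1\le i\le n,\ 1\le j\le s_i\}$ and edge set $\{\{x_{i,j},x_{k,l}\}: \{x_i,x_k\}\in E(G)\text{ or } i=k\}$ (with $(i,j)\ne(k,l)$). All graphs are finite and simple. For a graph $G=(V,E)$ and $x\in V$, $G\setminus x$ is the graph obtained by deleting $x$ and its incident edges; $N[x]$ is $x$ together with its neighbours, and $G\setminus N[x]$ is obtained by deleting all vertices of $N[x]$ and their incident edges. A graph is well-covered if all its maximal independent sets have the same cardinality. A graph $G$ is vertex decomposable if $G$ is well-covered and either (i) $G$ has no edges (possibly no vertices), or (ii) there is a vertex $x$ such that both $G\setminus x$ and $G\setminus N[x]$ are vertex decomposable. For a vertex decomposable graph $G$, $\mathrm{Shed}(G)$ is the set of vertices $x$ such that $G\setminus x$ and $G\setminus N[x]$ are both vertex decomposable. A set $D\subseteq V$ is dominating if every vertex of $V\setminus D$ is adjacent to a vertex of $D$. -}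

module Defs where

open import Data.Bool using (Bool; true; false; _∧_; _∨_; not; T)
open import Data.Nat using (ℕ; zero; suc; _≤_)
open import Data.Fin using (Fin)
open import Data.Fin.Properties using () renaming (_≟_ to _≟F_)
open import Data.List using (List; []; _∷_; length; deduplicate; map; concatMap; allFin)
open import Data.List.Membership.Propositional using (_∈_)
open import Data.Product using (Σ; _×_; _,_; ∃; proj₁; proj₂)
open import Data.Product.Properties using (≡-dec)
open import Data.Sum using (_⊎_)
open import Relation.Binary.PropositionalEquality using (_≡_; refl; sym; trans; cong; cong₂; subst)
open import Relation.Nullary using (yes; no)
open import Data.Empty using (⊥-elim)
open import Data.Bool.Properties using (∧-zeroʳ)
open import Function using (_|>_; _⟨_⟩_)
open import Relation.Binary.Definitions using (DecidableEquality)
open import Relation.Nullary.Decidable using (⌊_⌋)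

record Graph : Set₁ where
  field
    V          : Set
    _≟_        : DecidableEquality V
    verts      : List V
    adj        : V → V → Bool
    adj-sym    : ∀ u v → adj u v ≡ adj v u
    adj-irrefl : ∀ v → adj v v ≡ false

-- Vertex subsets (used for induced subgraphs G[S]) as Boolean predicates.
module _ (G : Graph) where
  open Graph G

  Sub : Set
  Sub = V → Bool

  full : Sub
  full _ = true

  Mem : Sub → V → Set
  Mem S v = (v ∈ verts) × (S v ≡ true)

  card : Sub → ℕ
  card I = length (deduplicate _≟_ (Data.List.filter (λ v → Data.Bool.T? (I v)) verts))

  Independent : Sub → Sub → Set
  Independent S I =
    (∀ v → I v ≡ true → Mem S v) ×
    (∀ u v → I u ≡ true → I v ≡ true → adj u v ≡ false)

  MaximalIndependent : Sub → Sub → Set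
  MaximalIndependent S I =
    Independent S I ×
    (∀ J → Independent S J → (∀ v → I v ≡ true → J v ≡ true) →
       ∀ v → J v ≡ true → I v ≡ true)

  WellCovered : Sub → Set
  WellCovered S = ∀ I J → MaximalIndependent S I → MaximalIndependent S J →
                  card I ≡ card J

  Edgeless : Sub → Set
  Edgeless S = ∀ u v → Mem S u → Mem S v → adj u v ≡ false

  del : Sub → V → Sub
  del S x v = S v ∧ not ⌊ v ≟ x ⌋

  delN : Sub → V → Sub
  delN S x v = S v ∧ not ⌊ v ≟ x ⌋ ∧ not (adj x v)

  -- vertex decomposable (in the well-covered sense of the paper)
  data VD (S : Sub) : Set where
    vd-edgeless : WellCovered S → Edgeless S → VD S
    vd-shed     : WellCovered S → (x : V) → Mem S x →
                  VD (del S x) → VD (delN S x) → VD S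

  Shed : Sub → V → Set
  Shed S x = Mem S x × VD (del S x) × VD (delN S x)

  Dominating : Sub → (V → Set) → Set
  Dominating S D = ∀ v → Mem S v → D v ⊎ (∃ λ u → D u × Mem S u × adj u v ≡ true)

finGraph : (n : ℕ) (adj : Fin n → Fin n → Bool) →
           (∀ u v → adj u v ≡ adj v u) → (∀ v → adj v v ≡ false) → Graph
finGraph n a sym irr = record
  { V = Fin n ; _≟_ = _≟F_ ; verts = allFin n ; adj = a
  ; adj-sym = sym ; adj-irrefl = irr }

-- The graph expansion G^(s_1,…,s_n): vertex x_{i,j} is the pair (i , j), j < s i.
module _ (n : ℕ) (a : Fin n → Fin n → Bool) where
  expAdj : (s : Fin n → ℕ) → Σ (Fin n) (λ i → Fin (s i)) → Σ (Fin n) (λ i → Fin (s i)) → Bool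
  expAdj s (i , j) (k , l) =
    (a i k ∨ ⌊ i ≟F k ⌋) ∧ not ⌊ ≡-dec _≟F_ _≟F_ (i , j) (k , l) ⌋

  private
    dsym : {A : Set} (d : DecidableEquality A) (x y : A) → ⌊ d x y ⌋ ≡ ⌊ d y x ⌋
    dsym d x y with d x y | d y x
    ... | yes _ | yes _ = refl
    ... | no _ | no _ = refl
    ... | yes p | no q = ⊥-elim (q (sym p))
    ... | no p | yes q = ⊥-elim (p (sym q))

    drefl : {A : Set} (d : DecidableEquality A) (x : A) → ⌊ d x x ⌋ ≡ true
    drefl d x with d x x
    ... | yes _ = refl
    ... | no p = ⊥-elim (p refl)

  expansion : (∀ u v → a u v ≡ a v u) → (s : Fin n → ℕ) → Graph
  expansion asym s = record
    { V = Σ (Fin n) (λ i → Fin (s i))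
    ; _≟_ = ≡-dec _≟F_ _≟F_
    ; verts = concatMap (λ i → map (i ,_) (allFin (s i))) (allFin n)
    ; adj = expAdj s
    ; adj-sym = λ { (i , j) (k , l) →
        cong₂ (λ p q → (p ∨ q) ∧ not ⌊ ≡-dec _≟F_ _≟F_ (k , l) (i , j) ⌋) (asym i k) (dsym _≟F_ i k)
        ⟨ trans ⟩ cong (λ p → (a k i ∨ ⌊ k ≟F i ⌋) ∧ not p) refl
        |> λ e → subst (λ p → (a i k ∨ ⌊ i ≟F k ⌋) ∧ not p ≡ (a k i ∨ ⌊ k ≟F i ⌋) ∧ not ⌊ ≡-dec _≟F_ _≟F_ (k , l) (i , j) ⌋)
                  (sym (dsym (≡-dec _≟F_ _≟F_) (i , j) (k , l))) e }
    ; adj-irrefl = λ v → subst (λ p → (a (proj₁ v) (proj₁ v) ∨ ⌊ proj₁ v ≟F proj₁ v ⌋) ∧ not p ≡ false)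
                     (sym (drefl (≡-dec _≟F_ _≟F_) v)) (∧-zeroʳ _) }

-- Write H for the expansion of G. The statement is generalised from the whole graphs to
-- pairs T ⊆ V(G), T′ ⊆ V(H) such that T′ covers T: every vertex of T′ lies over T and every
-- vertex of T has at least one copy in T′, so H[T′] is again an expansion of G[T], with
-- multiplicities ≥ 1. An independent set of H[T′] meets each fibre at most once, so its
-- shadow in G[T] has the same size, and maximality is inherited; hence well-coveredness lifts.
-- Vertex decomposability lifts by induction on |T′|. If G[T] sheds x, H[T′] sheds a copy
-- (x , c): deleting N[(x , c)] leaves a cover of G[T] ∖ N[x], and deleting (x , c) leaves a
-- cover of G[T] if another copy of x remains and of G[T] ∖ x otherwise. If G[T] is edgeless
-- but H[T′] is not, an edge of H[T′] joins two copies of some i; shedding one of them leaves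
-- covers of G[T] and of G[T] ∖ N[i], and the latter is vertex decomposable since vertex
-- decomposability is preserved by deleting a closed neighbourhood. When every s i ≥ 2 each
-- vertex of H has a second copy, so the same two covers make every vertex a shedding vertex.

module Submission where

open import Defs
open import Algebra.Bundles using (CommutativeMonoid)
open import Data.Bool using (Bool; true; false; _∧_; _∨_; not; T?)
open import Data.Bool.Properties
  using (∧-commutativeMonoid; ∧-identityʳ; ∧-zeroʳ; ∨-identityʳ; ∨-zeroʳ; ¬-not; T-≡; ⇔→≡)
  renaming (_≟_ to _≟ᵇ_)
open import Data.Empty using (⊥-elim)
open import Data.List using (List; []; _∷_; length; map; filter; deduplicate; allFin)
open import Data.List.Properties using (length-removeAt′; length-map)
open import Data.List.Membership.Propositional using (_∈_; find; lose)
open import Data.List.Membership.Propositional.Properties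
  using ( ∈-filter⁺; ∈-filter⁻; ∈-deduplicate⁺; ∈-deduplicate⁻
        ; ∈-map⁺; ∈-map⁻; ∈-concatMap⁺; ∈-allFin)
open import Data.List.Relation.Binary.Subset.Propositional using (_⊆_)
open import Data.List.Relation.Unary.All as All using (All; []; _∷_)
import Data.List.Relation.Unary.All.Properties as All
open import Data.List.Relation.Unary.Any as Any using (here; there; _─_; any?)
open import Data.List.Relation.Unary.Unique.Propositional using (Unique; []; _∷_)
open import Data.List.Relation.Unary.Unique.DecPropositional.Properties using (deduplicate-!)
open import Data.Fin using (Fin; zero; fromℕ<; punchIn)
open import Data.Fin.Properties using (punchInᵢ≢i) renaming (_≟_ to _≟ᶠ_; any? to anyᶠ?)
open import Data.Nat using (ℕ; zero; suc; _≤_; _<_; z≤n; s≤s; s≤s⁻¹)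
open import Data.Nat.Properties
  using (≤-refl; <⇒≤; n<1+n; ≤-antisym; <-≤-trans; suc-injective; module ≤-Reasoning)
open import Data.Product using (Σ; ∃₂; _×_; _,_; proj₁; proj₂)
open import Data.Product.Properties using (≡-dec)
open import Data.Sum using (_⊎_; inj₁; inj₂)
open import Function using (_∘_; mk⇔; Equivalence)
open import Relation.Binary.PropositionalEquality
  using (_≡_; _≢_; _≗_; refl; sym; trans; cong; module ≡-Reasoning)
open import Relation.Binary.Definitions using (DecidableEquality)
open import Relation.Nullary using (Dec; yes; no; ¬?; _×-dec_)
open import Relation.Nullary.Decidable using (⌊_⌋; fromWitness; toWitness)

open import Algebra.Properties.CommutativeSemigroup
  (CommutativeMonoid.commutativeSemigroup ∧-commutativeMonoid) using (xy∙z≈xz∙y)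

true≢false : true ≢ false
true≢false ()

module _ {A : Set} where

  ∈-─ : ∀ {x z} {ys : List A} (x∈ys : x ∈ ys) → z ∈ ys → z ≢ x → z ∈ (ys ─ x∈ys)
  ∈-─ (here refl) (here refl) z≢x = ⊥-elim (z≢x refl)
  ∈-─ (here _)    (there z∈ys) _  = z∈ys
  ∈-─ (there _)   (here refl)  _  = here refl
  ∈-─ (there x∈ys) (there z∈ys) z≢x = there (∈-─ x∈ys z∈ys z≢x)

  Unique-length-≤ : ∀ {xs ys : List A} → Unique xs → xs ⊆ ys → length xs ≤ length ys
  Unique-length-≤ {[]} _ _ = z≤n
  Unique-length-≤ {x ∷ xs} {ys} (x∉xs ∷ xs!) xs⊆ys = begin
    suc (length xs)          ≤⟨ s≤s (Unique-length-≤ xs! xs⊆ys─x) ⟩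
    suc (length (ys ─ x∈ys)) ≡⟨ length-removeAt′ ys (Any.index x∈ys) ⟨
    length ys                ∎
    where
    open ≤-Reasoning
    x∈ys = xs⊆ys (here refl)
    xs⊆ys─x : xs ⊆ (ys ─ x∈ys)
    xs⊆ys─x z∈xs = ∈-─ x∈ys (xs⊆ys (there z∈xs)) (λ z≡x → All.lookup x∉xs z∈xs (sym z≡x))

  Unique-map⁺ : ∀ {B : Set} {f : A → B} {xs : List A} →
                (∀ {u v} → u ∈ xs → v ∈ xs → f u ≡ f v → u ≡ v) →
                Unique xs → Unique (map f xs)
  Unique-map⁺ _ [] = []
  Unique-map⁺ f-inj (x∉xs ∷ xs!) =
    All.map⁺ (All.tabulate λ v∈xs fx≡fv →
                All.lookup x∉xs v∈xs (f-inj (here refl) (there v∈xs) fx≡fv))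
    ∷ Unique-map⁺ (λ u∈ v∈ → f-inj (there u∈) (there v∈)) xs!

another-index : ∀ {m} → 2 ≤ m → (j : Fin m) → Σ (Fin m) (_≢ j)
another-index (s≤s (s≤s _)) j = punchIn j zero , punchInᵢ≢i j zero

module InducedSubgraphs (G : Graph) where
  open Graph G

  infix 4 _⊆ᵇ_
  _⊆ᵇ_ : Sub G → Sub G → Set
  I ⊆ᵇ J = ∀ v → I v ≡ true → J v ≡ true

  ≗⇒⊆ᵇ : ∀ {I J} → I ≗ J → I ⊆ᵇ J
  ≗⇒⊆ᵇ I≗J v Iv = trans (sym (I≗J v)) Iv

  elements : Sub G → List V
  elements I = deduplicate _≟_ (filter (λ v → T? (I v)) verts)

  ∈-elements⁺ : ∀ {I v} → Mem G I v → v ∈ elements I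
  ∈-elements⁺ {I} (v∈ , Iv) =
    ∈-deduplicate⁺ _≟_ (∈-filter⁺ (λ v → T? (I v)) v∈ (Equivalence.from T-≡ Iv))

  ∈-elements⁻ : ∀ {I v} → v ∈ elements I → Mem G I v
  ∈-elements⁻ {I} v∈ with v∈′ , Iv ← ∈-filter⁻ (λ v → T? (I v)) (∈-deduplicate⁻ _≟_ _ v∈) =
    v∈′ , Equivalence.to T-≡ Iv

  elements-unique : ∀ I → Unique (elements I)
  elements-unique I = deduplicate-! _≟_ _

  card-mono : ∀ {I J} → I ⊆ᵇ J → card G I ≤ card G J
  card-mono {I} {J} I⊆J = Unique-length-≤ (elements-unique I) λ v∈ →
    let v∈V , Iv = ∈-elements⁻ v∈ in ∈-elements⁺ {J} (v∈V , I⊆J _ Iv)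

  card-resp-≗ : ∀ {I J} → I ≗ J → card G I ≡ card G J
  card-resp-≗ I≗J = ≤-antisym (card-mono (≗⇒⊆ᵇ I≗J)) (card-mono (≗⇒⊆ᵇ (sym ∘ I≗J)))

  insert : Sub G → V → Sub G
  insert I y v = I v ∨ ⌊ v ≟ y ⌋

  insert-⊇ : ∀ {I y} → I ⊆ᵇ insert I y
  insert-⊇ v Iv rewrite Iv = refl

  insert-∋ : ∀ {I y} → insert I y y ≡ true
  insert-∋ {I} {y} with y ≟ y
  ... | yes _   = ∨-zeroʳ (I y)
  ... | no y≢y = ⊥-elim (y≢y refl)

  insert-true⁻ : ∀ {I y v} → insert I y v ≡ true → I v ≡ true ⊎ v ≡ y
  insert-true⁻ {I} {y} {v} e with I v | v ≟ y
  ... | true  | _       = inj₁ refl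
  ... | false | yes v≡y = inj₂ v≡y

  card-insert : ∀ {I y} → y ∈ verts → I y ≡ false → card G (insert I y) ≡ suc (card G I)
  card-insert {I} {y} y∈V Iy = ≤-antisym
    (Unique-length-≤ (elements-unique _) elements-insert⊆)
    (Unique-length-≤ (y∉ ∷ elements-unique I) ⊆elements-insert)
    where
    elements-insert⊆ : elements (insert I y) ⊆ y ∷ elements I
    elements-insert⊆ v∈ with v∈V , e ← ∈-elements⁻ v∈ | insert-true⁻ {I} e
    ... | inj₁ Iv   = there (∈-elements⁺ (v∈V , Iv))
    ... | inj₂ refl = here refl
    y∉ : All (y ≢_) (elements I)
    y∉ = All.tabulate λ { v∈ refl → true≢false (trans (sym (proj₂ (∈-elements⁻ v∈))) Iy) }
    ⊆elements-insert : y ∷ elements I ⊆ elements (insert I y)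
    ⊆elements-insert (here refl) = ∈-elements⁺ (y∈V , insert-∋ {I})
    ⊆elements-insert (there v∈) =
      let v∈V , Iv = ∈-elements⁻ v∈ in ∈-elements⁺ (v∈V , insert-⊇ {I} _ Iv)

  del-true⁻ : ∀ {S x v} → del G S x v ≡ true → S v ≡ true × v ≢ x
  del-true⁻ {S} {x} {v} e with S v | v ≟ x | e
  ... | true  | no v≢x | _  = refl , v≢x
  ... | true  | yes _  | ()
  ... | false | _      | ()

  del-true⁺ : ∀ {S x v} → S v ≡ true → v ≢ x → del G S x v ≡ true
  del-true⁺ {S} {x} {v} Sv v≢x with v ≟ x
  ... | yes v≡x = ⊥-elim (v≢x v≡x)
  ... | no _    = trans (∧-identityʳ (S v)) Sv

  del-∌ : ∀ {S x} → del G S x x ≡ false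
  del-∌ {S} {x} with x ≟ x
  ... | yes _   = ∧-zeroʳ (S x)
  ... | no x≢x = ⊥-elim (x≢x refl)

  delN-true⁻ : ∀ {S x v} → delN G S x v ≡ true → S v ≡ true × v ≢ x × adj x v ≡ false
  delN-true⁻ {S} {x} {v} e with S v | v ≟ x | adj x v | e
  ... | true  | no v≢x | false | _  = refl , v≢x , refl
  ... | true  | no _   | true  | ()
  ... | true  | yes _  | _     | ()
  ... | false | _      | _     | ()

  delN-true⁺ : ∀ {S x v} → S v ≡ true → v ≢ x → adj x v ≡ false → delN G S x v ≡ true
  delN-true⁺ {S} {x} {v} Sv v≢x xv with v ≟ x
  ... | yes v≡x = ⊥-elim (v≢x v≡x)
  ... | no _ rewrite xv = trans (∧-identityʳ (S v)) Sv

  delN⊆del : ∀ {S x} → delN G S x ⊆ᵇ del G S x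
  delN⊆del {S} v e = let Sv , v≢x , _ = delN-true⁻ {S} e in del-true⁺ {S} Sv v≢x

  insert-del : ∀ {S u} → S u ≡ true → insert (del G S u) u ≗ S
  insert-del {S} {u} Su v with v ≟ u
  ... | yes refl = trans (∨-zeroʳ _) (sym Su)
  ... | no _     = trans (∨-identityʳ _) (∧-identityʳ (S v))

  card-del-< : ∀ {S S′ u} → Mem G S u → S′ ⊆ᵇ del G S u → card G S′ < card G S
  card-del-< {S} {S′} {u} (u∈V , Su) S′⊆ = begin-strict
    card G S′                        ≤⟨ card-mono S′⊆ ⟩
    card G (del G S u)               <⟨ s≤s ≤-refl ⟩
    suc (card G (del G S u))         ≡⟨ card-insert {del G S u} u∈V (del-∌ {S}) ⟨
    card G (insert (del G S u) u)    ≡⟨ card-resp-≗ (insert-del {S} Su) ⟩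
    card G S                         ∎
    where open ≤-Reasoning

  delN-⊆ : ∀ {S x} → delN G S x ⊆ᵇ S
  delN-⊆ {S} v e = proj₁ (delN-true⁻ {S} e)

  Mem-mono : ∀ {S S′ v} → S ⊆ᵇ S′ → Mem G S v → Mem G S′ v
  Mem-mono S⊆S′ (v∈V , Sv) = v∈V , S⊆S′ _ Sv

  Independent-mono : ∀ {S S′ I} → S ⊆ᵇ S′ → Independent G S I → Independent G S′ I
  Independent-mono S⊆S′ (I⊆ , I-indep) = (λ v Iv → Mem-mono S⊆S′ (I⊆ v Iv)) , I-indep

  Independent-insert : ∀ {S I y} → Independent G S I → Mem G S y →
                       (∀ v → I v ≡ true → adj y v ≡ false) → Independent G S (insert I y)
  Independent-insert {S} {I} {y} (I⊆ , I-indep) y∈S y-indep = I+y⊆ , I+y-indep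
    where
    I+y⊆ : ∀ v → insert I y v ≡ true → Mem G S v
    I+y⊆ v e with insert-true⁻ {I} e
    ... | inj₁ Iv   = I⊆ v Iv
    ... | inj₂ refl = y∈S
    I+y-indep : ∀ u v → insert I y u ≡ true → insert I y v ≡ true → adj u v ≡ false
    I+y-indep u v eu ev with insert-true⁻ {I} eu | insert-true⁻ {I} ev
    ... | inj₁ Iu   | inj₁ Iv   = I-indep u v Iu Iv
    ... | inj₁ Iu   | inj₂ refl = trans (adj-sym u y) (y-indep u Iu)
    ... | inj₂ refl | inj₁ Iv   = y-indep v Iv
    ... | inj₂ refl | inj₂ refl = adj-irrefl y

  MaximalIndependent-resp-≗ : ∀ {S S′ I} → S ≗ S′ →
                              MaximalIndependent G S I → MaximalIndependent G S′ I
  MaximalIndependent-resp-≗ S≗S′ (I-indep , I-max) =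
    Independent-mono (≗⇒⊆ᵇ S≗S′) I-indep ,
    λ J J-indep → I-max J (Independent-mono (≗⇒⊆ᵇ (sym ∘ S≗S′)) J-indep)

  WellCovered-resp-≗ : ∀ {S S′} → S ≗ S′ → WellCovered G S → WellCovered G S′
  WellCovered-resp-≗ S≗S′ wc I J I-max J-max =
    wc I J (MaximalIndependent-resp-≗ (sym ∘ S≗S′) I-max)
           (MaximalIndependent-resp-≗ (sym ∘ S≗S′) J-max)

  VD-resp-≗ : ∀ {S S′} → S ≗ S′ → VD G S → VD G S′
  VD-resp-≗ S≗S′ (vd-edgeless wc edgeless) =
    vd-edgeless (WellCovered-resp-≗ S≗S′ wc)
      λ u v u∈ v∈ → edgeless u v (Mem-mono (≗⇒⊆ᵇ (sym ∘ S≗S′)) u∈) (Mem-mono (≗⇒⊆ᵇ (sym ∘ S≗S′)) v∈)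
  VD-resp-≗ S≗S′ (vd-shed wc x x∈S S∖x S∖Nx) =
    vd-shed (WellCovered-resp-≗ S≗S′ wc) x (Mem-mono (≗⇒⊆ᵇ S≗S′) x∈S)
      (VD-resp-≗ (λ v → cong (λ b → b ∧ not ⌊ v ≟ x ⌋) (S≗S′ v)) S∖x)
      (VD-resp-≗ (λ v → cong (λ b → b ∧ not ⌊ v ≟ x ⌋ ∧ not (adj x v)) (S≗S′ v)) S∖Nx)

  VD⇒WellCovered : ∀ {S} → VD G S → WellCovered G S
  VD⇒WellCovered (vd-edgeless wc _)    = wc
  VD⇒WellCovered (vd-shed wc _ _ _ _) = wc

  Independent-delN-∌ : ∀ {S y I} → Independent G (delN G S y) I → I y ≡ false
  Independent-delN-∌ {S} {y} {I} (I⊆ , _) with I y in Iy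
  ... | false = refl
  ... | true  = ⊥-elim (proj₁ (proj₂ (delN-true⁻ {S} (proj₂ (I⊆ y Iy)))) refl)

  MaximalIndependent-insert : ∀ {S y I} → Mem G S y →
                              MaximalIndependent G (delN G S y) I →
                              MaximalIndependent G S (insert I y)
  MaximalIndependent-insert {S} {y} {I} y∈S ((I⊆ , I-indep) , I-max) =
    Independent-insert (Independent-mono (delN-⊆ {S}) (I⊆ , I-indep)) y∈S y-indep , I+y-max
    where
    y-indep : ∀ v → I v ≡ true → adj y v ≡ false
    y-indep v Iv = proj₂ (proj₂ (delN-true⁻ {S} (proj₂ (I⊆ v Iv))))
    I+y-max : ∀ J → Independent G S J → insert I y ⊆ᵇ J → J ⊆ᵇ insert I y
    I+y-max J (J⊆ , J-indep) I+y⊆J v Jv with v ≟ y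
    ... | yes refl = ∨-zeroʳ (I v)
    ... | no v≢y   = trans (∨-identityʳ (I v)) (I-max (delN G J y) J∖Ny-indep I⊆J∖Ny v
                       (delN-true⁺ {J} Jv v≢y (J-indep y v Jy Jv)))
      where
      Jy = I+y⊆J y (insert-∋ {I})
      J∖Ny-indep : Independent G (delN G S y) (delN G J y)
      J∖Ny-indep =
        (λ w e → let Jw , w≢y , yw = delN-true⁻ {J} e
                     w∈V , Sw = J⊆ w Jw
                 in w∈V , delN-true⁺ {S} Sw w≢y yw) ,
        λ u w eu ew → J-indep u w (delN-⊆ {J} u eu) (delN-⊆ {J} w ew)
      I⊆J∖Ny : I ⊆ᵇ delN G J y
      I⊆J∖Ny w Iw = let _ , w≢y , yw = delN-true⁻ {S} (proj₂ (I⊆ w Iw))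
                    in delN-true⁺ {J} (I+y⊆J w (insert-⊇ {I} w Iw)) w≢y yw

  WellCovered-delN : ∀ {S y} → Mem G S y → WellCovered G S → WellCovered G (delN G S y)
  WellCovered-delN {S} {y} y∈S@(y∈V , _) wc I J I-max J-max = suc-injective (begin
    suc (card G I)       ≡⟨ card-insert y∈V (Independent-delN-∌ {S} (proj₁ I-max)) ⟨
    card G (insert I y)  ≡⟨ wc _ _ (MaximalIndependent-insert y∈S I-max)
                                   (MaximalIndependent-insert y∈S J-max) ⟩
    card G (insert J y)  ≡⟨ card-insert y∈V (Independent-delN-∌ {S} (proj₁ J-max)) ⟩
    suc (card G J)       ∎)
    where open ≡-Reasoning

  delN-del-adjacent : ∀ {S y z} → adj y z ≡ true → delN G (del G S z) y ≗ delN G S y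
  delN-del-adjacent {S} {y} {z} yz v = ⇔→≡ {z = true} (mk⇔
    (λ e → let S∖z-v , v≢y , yv = delN-true⁻ {del G S z} e
           in delN-true⁺ {S} (proj₁ (del-true⁻ {S} S∖z-v)) v≢y yv)
    (λ e → let Sv , v≢y , yv = delN-true⁻ {S} e
               v≢z = λ { refl → true≢false (trans (sym yz) yv) }
           in delN-true⁺ {del G S z} (del-true⁺ {S} Sv v≢z) v≢y yv))

  delN-del-comm : ∀ {S y z} → delN G (del G S z) y ≗ del G (delN G S y) z
  delN-del-comm {S} v = xy∙z≈xz∙y (S v) _ _

  delN-delN-comm : ∀ {S y z} → delN G (delN G S z) y ≗ delN G (delN G S y) z
  delN-delN-comm {S} v = xy∙z≈xz∙y (S v) _ _

  VD-delN : ∀ {S} → VD G S → ∀ {y} → Mem G S y → VD G (delN G S y)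
  VD-delN {S} (vd-edgeless wc edgeless) y∈S =
    vd-edgeless (WellCovered-delN y∈S wc)
      λ u v u∈ v∈ → edgeless u v (Mem-mono (delN-⊆ {S}) u∈) (Mem-mono (delN-⊆ {S}) v∈)
  VD-delN {S} (vd-shed wc z z∈S S∖z S∖Nz) {y} y∈S@(y∈V , Sy) with y ≟ z
  ... | yes refl = S∖Nz
  ... | no y≢z with adj y z in yz
  ...   | true  = VD-resp-≗ (delN-del-adjacent {S} yz)
                    (VD-delN S∖z (y∈V , del-true⁺ {S} Sy y≢z))
  ...   | false = vd-shed (WellCovered-delN y∈S wc) z
                    (proj₁ z∈S , delN-true⁺ {S} (proj₂ z∈S) (λ z≡y → y≢z (sym z≡y)) yz)
                    (VD-resp-≗ (delN-del-comm {S}) (VD-delN S∖z (y∈V , del-true⁺ {S} Sy y≢z)))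
                    (VD-resp-≗ (delN-delN-comm {S}) (VD-delN S∖Nz (y∈V , delN-true⁺ {S} Sy y≢z zy)))
    where zy = trans (adj-sym z y) yz

  private
    Edge? : (S : Sub G) (u v : V) → Dec (S u ≡ true × S v ≡ true × adj u v ≡ true)
    Edge? S u v = (S u ≟ᵇ true) ×-dec (S v ≟ᵇ true) ×-dec (adj u v ≟ᵇ true)

  edgeless? : (S : Sub G) → Edgeless G S ⊎ ∃₂ λ u v → Mem G S u × Mem G S v × adj u v ≡ true
  edgeless? S with any? (λ u → any? (Edge? S u) verts) verts
  ... | yes some-edge =
    let u , u∈V , some-v      = find some-edge
        v , v∈V , Su , Sv , uv = find some-v
    in inj₂ (u , v , (u∈V , Su) , (v∈V , Sv) , uv)
  ... | no no-edge = inj₁ λ u v (u∈V , Su) (v∈V , Sv) →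
    ¬-not λ uv → no-edge (lose u∈V (lose v∈V (Su , Sv , uv)))

module Expansion (n : ℕ) (a : Fin n → Fin n → Bool) (asym : ∀ u v → a u v ≡ a v u)
                 (airr : ∀ v → a v v ≡ false) (s : Fin n → ℕ) where

  G H : Graph
  G = finGraph n a asym airr
  H = expansion n a asym s

  open InducedSubgraphs G using (_⊆ᵇ_)
  private
    module ᴳ = InducedSubgraphs G
    module ᴴ = InducedSubgraphs H

  Copy : Set
  Copy = Graph.V H

  _≟ᴴ_ : DecidableEquality Copy
  _≟ᴴ_ = ≡-dec _≟ᶠ_ _≟ᶠ_

  adjᴴ : Copy → Copy → Bool
  adjᴴ = Graph.adj H

  Memᴳ : ∀ {T : Sub G} {i} → T i ≡ true → Mem G T i
  Memᴳ {i = i} Ti = ∈-allFin i , Ti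

  Memᴴ : ∀ {T′ : Sub H} {u} → T′ u ≡ true → Mem H T′ u
  Memᴴ {u = i , j} T′u =
    ∈-concatMap⁺ (λ i → map (i ,_) (allFin (s i)))
                 (Any.map (λ { refl → ∈-map⁺ (i ,_) (∈-allFin j) }) (∈-allFin i)) ,
    T′u

  adjᴴ-between : ∀ {i j k l} → a i k ≡ true → adjᴴ (i , j) (k , l) ≡ true
  adjᴴ-between {i} {j} {k} {l} ik rewrite ik with (i , j) ≟ᴴ (k , l)
  ... | yes refl = ⊥-elim (true≢false (trans (sym ik) (airr i)))
  ... | no _     = refl

  adjᴴ-within : ∀ {i j l} → j ≢ l → adjᴴ (i , j) (i , l) ≡ true
  adjᴴ-within {i} {j} {l} j≢l rewrite airr i with (i , j) ≟ᴴ (i , l)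
  ... | yes refl = ⊥-elim (j≢l refl)
  ... | no _ with i ≟ᶠ i
  ...   | yes _   = refl
  ...   | no i≢i = ⊥-elim (i≢i refl)

  same-fibre : ∀ {i j k l} → a i k ≡ false → adjᴴ (i , j) (k , l) ≡ true → i ≡ k
  same-fibre {i} {k = k} ik e rewrite ik with i ≟ᶠ k
  ... | yes i≡k = i≡k
  ... | no _    = ⊥-elim (true≢false (sym e))

  adjᴴ-nonadjacent : ∀ {i j k l} → a i k ≡ false → i ≢ k → adjᴴ (i , j) (k , l) ≡ false
  adjᴴ-nonadjacent {i} {k = k} ik i≢k rewrite ik with i ≟ᶠ k
  ... | yes i≡k = ⊥-elim (i≢k i≡k)
  ... | no _    = refl

  record Covers (T′ : Sub H) (T : Sub G) : Set where
    field
      lies-over : ∀ {i j} → T′ (i , j) ≡ true → T i ≡ true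
      copy      : ∀ {i} → T i ≡ true → Σ (Fin (s i)) λ j → T′ (i , j) ≡ true

  shadow : Sub H → Sub G
  shadow I i = ⌊ anyᶠ? (λ j → I (i , j) ≟ᵇ true) ⌋

  shadow-true⁺ : ∀ {I : Sub H} {i j} → I (i , j) ≡ true → shadow I i ≡ true
  shadow-true⁺ {j = j} Iij = Equivalence.to T-≡ (fromWitness (j , Iij))

  shadow-true⁻ : ∀ {I : Sub H} {i} → shadow I i ≡ true → Σ (Fin (s i)) λ j → I (i , j) ≡ true
  shadow-true⁻ e = toWitness (Equivalence.from T-≡ e)

  fibre-injective : ∀ {I : Sub H} → (∀ u v → I u ≡ true → I v ≡ true → adjᴴ u v ≡ false) →
                    ∀ {u v} → I u ≡ true → I v ≡ true → proj₁ u ≡ proj₁ v → u ≡ v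
  fibre-injective I-indep {i , j} {.i , l} Iu Iv refl with j ≟ᶠ l
  ... | yes refl = refl
  ... | no j≢l   = ⊥-elim (true≢false (trans (sym (adjᴴ-within j≢l)) (I-indep _ _ Iu Iv)))

  card-shadow : ∀ {I : Sub H} → (∀ u v → I u ≡ true → I v ≡ true → adjᴴ u v ≡ false) →
                card H I ≡ card G (shadow I)
  card-shadow {I} I-indep = begin
    card H I                           ≡⟨ length-map proj₁ (ᴴ.elements I) ⟨
    length (map proj₁ (ᴴ.elements I))  ≡⟨ ≤-antisym
      (Unique-length-≤ (Unique-map⁺ fibres-injective (ᴴ.elements-unique I)) fibres⊆shadow)
      (Unique-length-≤ (ᴳ.elements-unique (shadow I)) shadow⊆fibres) ⟩
    card G (shadow I)                  ∎
    where
    open ≡-Reasoning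
    fibres-injective : ∀ {u v} → u ∈ ᴴ.elements I → v ∈ ᴴ.elements I → proj₁ u ≡ proj₁ v → u ≡ v
    fibres-injective u∈ v∈ =
      fibre-injective {I} I-indep (proj₂ (ᴴ.∈-elements⁻ u∈)) (proj₂ (ᴴ.∈-elements⁻ v∈))
    fibres⊆shadow : map proj₁ (ᴴ.elements I) ⊆ ᴳ.elements (shadow I)
    fibres⊆shadow i∈ with (i , j) , u∈ , refl ← ∈-map⁻ proj₁ i∈ =
      ᴳ.∈-elements⁺ (Memᴳ {shadow I} (shadow-true⁺ {I} (proj₂ (ᴴ.∈-elements⁻ u∈))))
    shadow⊆fibres : ᴳ.elements (shadow I) ⊆ map proj₁ (ᴴ.elements I)
    shadow⊆fibres {i} i∈ with j , Iij ← shadow-true⁻ {I} (proj₂ (ᴳ.∈-elements⁻ i∈)) =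
      ∈-map⁺ proj₁ (ᴴ.∈-elements⁺ (Memᴴ {I} Iij))

  module _ {T : Sub G} {T′ : Sub H} (cov : Covers T′ T) where
    open Covers cov

    MaximalIndependent-shadow : ∀ {I} → MaximalIndependent H T′ I →
                                MaximalIndependent G T (shadow I)
    MaximalIndependent-shadow {I} ((I⊆ , I-indep) , I-max) =
      (shadow⊆ , shadow-indep) , shadow-max
      where
      shadow⊆ : ∀ i → shadow I i ≡ true → Mem G T i
      shadow⊆ i e = let _ , Iij = shadow-true⁻ {I} e in Memᴳ {T} (lies-over (proj₂ (I⊆ _ Iij)))
      shadow-indep : ∀ i k → shadow I i ≡ true → shadow I k ≡ true → a i k ≡ false
      shadow-indep i k ei ek = ¬-not λ ik →
        let _ , Iij = shadow-true⁻ {I} ei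
            _ , Ikl = shadow-true⁻ {I} ek
        in true≢false (trans (sym (adjᴴ-between ik)) (I-indep _ _ Iij Ikl))
      shadow-max : ∀ J → Independent G T J → shadow I ⊆ᵇ J → J ⊆ᵇ shadow I
      shadow-max J (J⊆ , J-indep) shadow⊆J i Ji with shadow I i in i∉shadow
      ... | true  = refl
      ... | false = ⊥-elim (true≢false (trans (sym (shadow-true⁺ {I} I∋c)) i∉shadow))
        where
        Ti = proj₂ (J⊆ i Ji)
        c = (i , proj₁ (copy Ti))
        c-indep : ∀ w → I w ≡ true → adjᴴ c w ≡ false
        c-indep (k , l) Ikl =
          adjᴴ-nonadjacent (J-indep i k Ji (shadow⊆J k (shadow-true⁺ {I} Ikl)))
                     λ { refl → true≢false (trans (sym (shadow-true⁺ {I} Ikl)) i∉shadow) }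
        I∋c : I c ≡ true
        I∋c = I-max (ᴴ.insert I c)
                    (ᴴ.Independent-insert (I⊆ , I-indep) (Memᴴ {T′} (proj₂ (copy Ti))) c-indep)
                    (ᴴ.insert-⊇ {I}) c (ᴴ.insert-∋ {I})

    WellCovered-Covers : WellCovered G T → WellCovered H T′
    WellCovered-Covers wc I J I-max J-max = begin
      card H I           ≡⟨ card-shadow {I} (proj₂ (proj₁ I-max)) ⟩
      card G (shadow I)  ≡⟨ wc _ _ (MaximalIndependent-shadow I-max)
                                   (MaximalIndependent-shadow J-max) ⟩
      card G (shadow J)  ≡⟨ card-shadow {J} (proj₂ (proj₁ J-max)) ⟨
      card H J           ∎
      where open ≡-Reasoning

    Covers-delN : ∀ {i j} → Covers (delN H T′ (i , j)) (delN G T i)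
    Covers-delN {i} {j} = record { lies-over = over ; copy = copy′ }
      where
      over : ∀ {k l} → delN H T′ (i , j) (k , l) ≡ true → delN G T i k ≡ true
      over {k} {l} e =
        let T′kl , kl≢ij , ij-kl = ᴴ.delN-true⁻ {T′} e
            k≢i : k ≢ i
            k≢i = λ { refl → true≢false (trans (sym (adjᴴ-within λ { refl → kl≢ij refl })) ij-kl) }
            ik : a i k ≡ false
            ik = ¬-not λ ik → true≢false (trans (sym (adjᴴ-between ik)) ij-kl)
        in ᴳ.delN-true⁺ {T} (lies-over T′kl) k≢i ik
      copy′ : ∀ {k} → delN G T i k ≡ true → Σ (Fin (s k)) λ l → delN H T′ (i , j) (k , l) ≡ true
      copy′ e =
        let Tk , k≢i , ik = ᴳ.delN-true⁻ {T} e
            l , T′kl = copy Tk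
        in l , ᴴ.delN-true⁺ {T′} T′kl (λ kl≡ij → k≢i (cong proj₁ kl≡ij))
                                      (adjᴴ-nonadjacent ik λ i≡k → k≢i (sym i≡k))

    Covers-del-copy : ∀ {i j l} → T′ (i , l) ≡ true → l ≢ j → Covers (del H T′ (i , j)) T
    Covers-del-copy {i} {j} {l} T′il l≢j =
      record { lies-over = λ e → lies-over (proj₁ (ᴴ.del-true⁻ {T′} e)) ; copy = copy′ }
      where
      copy′ : ∀ {k} → T k ≡ true → Σ (Fin (s k)) λ m → del H T′ (i , j) (k , m) ≡ true
      copy′ {k} Tk with copy Tk
      ... | m , T′km with (k , m) ≟ᴴ (i , j)
      ...   | yes refl = l , ᴴ.del-true⁺ {T′} T′il λ { refl → l≢j refl }
      ...   | no km≢ij = m , ᴴ.del-true⁺ {T′} T′km km≢ij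

    Covers-del-last : ∀ {i j} → (∀ l → l ≢ j → T′ (i , l) ≡ false) →
                      Covers (del H T′ (i , j)) (del G T i)
    Covers-del-last {i} {j} no-other = record { lies-over = over ; copy = copy′ }
      where
      over : ∀ {k m} → del H T′ (i , j) (k , m) ≡ true → del G T i k ≡ true
      over {k} {m} e =
        let T′km , km≢ij = ᴴ.del-true⁻ {T′} e
            k≢i : k ≢ i
            k≢i = λ { refl → true≢false (trans (sym T′km) (no-other m λ { refl → km≢ij refl })) }
        in ᴳ.del-true⁺ {T} (lies-over T′km) k≢i
      copy′ : ∀ {k} → del G T i k ≡ true → Σ (Fin (s k)) λ m → del H T′ (i , j) (k , m) ≡ true
      copy′ e =
        let Tk , k≢i = ᴳ.del-true⁻ {T} e
            m , T′km = copy Tk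
        in m , ᴴ.del-true⁺ {T′} T′km λ km≡ij → k≢i (cong proj₁ km≡ij)

  another-copy? : (T′ : Sub H) (i : Fin n) (j : Fin (s i)) →
                  (Σ (Fin (s i)) λ l → T′ (i , l) ≡ true × l ≢ j) ⊎
                  (∀ l → l ≢ j → T′ (i , l) ≡ false)
  another-copy? T′ i j with anyᶠ? (λ l → (T′ (i , l) ≟ᵇ true) ×-dec ¬? (l ≟ᶠ j))
  ... | yes other = inj₁ other
  ... | no  none  = inj₂ λ l l≢j → ¬-not λ T′il → none (l , T′il , l≢j)

  del-fuel : ∀ {k T′ u} → Mem H T′ u → card H T′ < suc k → card H (del H T′ u) < k
  del-fuel {T′ = T′} u∈ T′<k = <-≤-trans (ᴴ.card-del-< u∈ λ _ e → e) (s≤s⁻¹ T′<k)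

  delN-fuel : ∀ {k T′ u} → Mem H T′ u → card H T′ < suc k → card H (delN H T′ u) < k
  delN-fuel {T′ = T′} u∈ T′<k = <-≤-trans (ᴴ.card-del-< u∈ (ᴴ.delN⊆del {T′})) (s≤s⁻¹ T′<k)

  VD-Covers : ∀ k {T T′} → card H T′ < k → Covers T′ T → VD G T → VD H T′
  VD-Covers zero () _ _
  VD-Covers (suc k) {T} {T′} T′<k cov vdT with ᴴ.edgeless? T′ | vdT
  ... | inj₁ edgeless | _ =
    vd-edgeless (WellCovered-Covers cov (ᴳ.VD⇒WellCovered vdT)) edgeless
  ... | inj₂ ((i , j) , (i′ , l) , ij∈ , il∈ , ij-il) | vd-edgeless wcT edgelessT
    with refl ← same-fibre (edgelessT i i′ (Memᴳ {T} (Covers.lies-over cov (proj₂ ij∈)))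
                                           (Memᴳ {T} (Covers.lies-over cov (proj₂ il∈)))) ij-il =
    vd-shed (WellCovered-Covers cov wcT) (i , j) ij∈
      (VD-Covers k (del-fuel ij∈ T′<k) (Covers-del-copy cov (proj₂ il∈) l≢j) vdT)
      (VD-Covers k (delN-fuel ij∈ T′<k) (Covers-delN cov)
                   (ᴳ.VD-delN vdT (Memᴳ {T} (lies-over (proj₂ ij∈)))))
    where
    open Covers cov
    l≢j : l ≢ j
    l≢j refl = true≢false (trans (sym ij-il) (Graph.adj-irrefl H (i , j)))
  ... | inj₂ _ | vd-shed wcT x x∈T T∖x T∖Nx =
    vd-shed (WellCovered-Covers cov wcT) (x , c) xc∈
      del-branch
      (VD-Covers k (delN-fuel xc∈ T′<k) (Covers-delN cov) T∖Nx)
    where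
    open Covers cov
    c = proj₁ (copy (proj₂ x∈T))
    xc∈ = Memᴴ {T′} (proj₂ (copy (proj₂ x∈T)))
    del-branch : VD H (del H T′ (x , c))
    del-branch with another-copy? T′ x c
    ... | inj₁ (l , T′xl , l≢c) = VD-Covers k (del-fuel xc∈ T′<k) (Covers-del-copy cov T′xl l≢c) vdT
    ... | inj₂ no-other         = VD-Covers k (del-fuel xc∈ T′<k) (Covers-del-last cov no-other) T∖x

  VD-lift : ∀ {T T′} → Covers T′ T → VD G T → VD H T′
  VD-lift {T′ = T′} = VD-Covers (suc (card H T′)) (n<1+n _)

  Covers-full : (∀ i → 1 ≤ s i) → Covers (full H) (full G)
  Covers-full 1≤s = record { lies-over = λ _ → refl ; copy = λ {i} _ → fromℕ< (1≤s i) , refl }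

  VD-expansion : (∀ i → 1 ≤ s i) → VD G (full G) → VD H (full H)
  VD-expansion 1≤s = VD-lift (Covers-full 1≤s)

  Shed-expansion : (∀ i → 2 ≤ s i) → VD G (full G) → ∀ u → Shed H (full H) u
  Shed-expansion 2≤s vdG (i , j) =
    Memᴴ {full H} refl ,
    VD-lift (Covers-del-copy cov refl l≢j) vdG ,
    VD-lift (Covers-delN cov) (ᴳ.VD-delN vdG (Memᴳ {full G} refl))
    where
    cov = Covers-full λ i → <⇒≤ (2≤s i)
    l≢j = proj₂ (another-index (2≤s i) j)

theorem7p2 : (n : ℕ) (a : Fin n → Fin n → Bool)
             (asym : ∀ u v → a u v ≡ a v u) (airr : ∀ v → a v v ≡ false)
             (s : Fin n → ℕ) → (∀ i → 2 ≤ s i) →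
             VD (finGraph n a asym airr) (full (finGraph n a asym airr)) →
             Σ (VD (expansion n a asym s) (full (expansion n a asym s)))
               (λ _ → Dominating (expansion n a asym s) (full (expansion n a asym s))
                        (Shed (expansion n a asym s) (full (expansion n a asym s))))
theorem7p2 n a asym airr s 2≤s vdG =
  VD-expansion (λ i → <⇒≤ (2≤s i)) vdG ,
  λ u _ → inj₁ (Shed-expansion 2≤s vdG u)
  where open Expansion n a asym airr s
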